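{- Let $n$, $s$, $t$ be integers such that $\mathcal{G}(n,s,t)\neq\emptyset$. Then there is a pair $(R,B)\in\mathcal{M}(n,s,t)$ such that $R$ and $\partial R$ are left-shifted, while $B$ and $\partial B$ are right-shifted.
   Context: A $3$-graph is a $3$-uniform hypergraph; $e(\cdot)$ is its number of edges and $m(R)$ the size of a largest matching in $R$. Two $3$-graphs $R,B$ are distinguishable if every edge of $R$ and every edge of $B$ intersect in at most one vertex. $\mathcal{G}(n,s,t)$ is the family of pairs $(R,B)$ of distinguishable $3$-graphs on $\{1,\dots,n\}$ with $m(R)\le s$ and $e(R)>t$; $\mu(n,s,t)=\max\{e(R\cup B):(R,B)\in\mathcal{G}(n,s,t)\}$ and $\mathcal{M}(n,s,t)=\{(R,B)\in\mathcal{G}(n,s,t): e(R\cup B)=\mu(n,s,t)\}$. For a $k$-graph $G$ and vertices $i,j$, $\mathrm{sh}_{i\to j}(G)$ is obtained by replacing each edge $e$ by $f=(e\setminus\{i\})\cup\{j\}$ whenever $i\in e$, $j\notin e$ and $f\notin E(G)$. A $k$-graph $G$ on $\{1,\dots,n\}$ is left-shifted if $\mathrm{sh}_{j\to i}(G)=G$ for all $i<j$, and right-shifted if $\mathrm{sh}_{i\to j}(G)=G$ for all $i<j$. The shadow $\partial G$ of a $3$-graph $G$ is the graph on $V(G)$ whose edges are the pairs contained in some edge of $G$. -}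

module Defs where

open import Data.Bool using (Bool; true; false; _∧_; _∨_; not; if_then_else_)
open import Data.Nat using (ℕ; zero; suc; _≤_; _<_; _≡ᵇ_)
open import Data.Integer using (ℤ; +_) renaming (_≤_ to _≤ℤ_; _<_ to _<ℤ_)
open import Data.Fin using (Fin) renaming (_<_ to _<F_)
open import Data.Fin.Subset using (Subset; ⁅_⁆; _∩_; _∪_; _-_; ∣_∣)
open import Data.Fin.Subset.Properties using (_⊆?_)
open import Data.Vec using ([]; _∷_; lookup)
open import Data.List using (List; []; _∷_; _++_; map; length)
open import Data.Nat.ListAction using (sum)
open import Data.Bool.ListAction using (any)
open import Data.List.Relation.Unary.All using (All)
open import Data.List.Relation.Unary.AllPairs using (AllPairs)
open import Data.Product using (_×_)
open import Relation.Binary.PropositionalEquality using (_≡_)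
open import Relation.Nullary.Decidable using (⌊_⌋)

-- Vertices {1,…,n} are represented by Fin n (vertex v ↦ toℕ v + 1, order preserving).
-- A hypergraph on Fin n is given by its edge indicator on subsets of Fin n.
Hyp : ℕ → Set
Hyp n = Subset n → Bool

IsKGraph : ∀ {n} → ℕ → Hyp n → Set
IsKGraph k G = ∀ e → G e ≡ true → ∣ e ∣ ≡ k

allSubsets : (n : ℕ) → List (Subset n)
allSubsets zero = [] ∷ []
allSubsets (suc n) = map (false ∷_) (allSubsets n) ++ map (true ∷_) (allSubsets n)

edges# : ∀ {n} → Hyp n → ℕ
edges# {n} G = sum (map (λ e → if G e then 1 else 0) (allSubsets n))

_∪H_ : ∀ {n} → Hyp n → Hyp n → Hyp n
(G ∪H H) e = G e ∨ H e

IsMatching : ∀ {n} → Hyp n → List (Subset n) → Set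
IsMatching R M = All (λ e → R e ≡ true) M × AllPairs (λ e f → ∣ e ∩ f ∣ ≡ 0) M

MatchingAtMost : ∀ {n} → Hyp n → ℤ → Set
MatchingAtMost R s = ∀ M → IsMatching R M → + length M ≤ℤ s

Distinguishable : ∀ {n} → Hyp n → Hyp n → Set
Distinguishable R B = ∀ e f → R e ≡ true → B f ≡ true → ∣ e ∩ f ∣ ≤ 1

InG : (n : ℕ) → ℤ → ℤ → Hyp n → Hyp n → Set
InG n s t R B =
  IsKGraph 3 R × IsKGraph 3 B × Distinguishable R B
  × MatchingAtMost R s × t <ℤ + edges# R

-- (R , B) ∈ ℳ(n,s,t): in 𝒢(n,s,t) and e(R ∪ B) = μ(n,s,t), i.e. maximal over 𝒢(n,s,t)
InM : (n : ℕ) → ℤ → ℤ → Hyp n → Hyp n → Set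
InM n s t R B = InG n s t R B
  × (∀ R' B' → InG n s t R' B' → edges# (R' ∪H B') ≤ edges# (R ∪H B))

_∈ᵇ_ : ∀ {n} → Fin n → Subset n → Bool
i ∈ᵇ x = lookup x i

-- sh_{i→j}(G): each edge e with i ∈ e, j ∉ e, and f = (e ∖ {i}) ∪ {j} ∉ G is replaced by f.
-- x is an edge of sh_{i→j}(G) iff
--   x ∈ G and x is not replaced, or
--   x ∉ G, j ∈ x, i ∉ x and x = f for the edge e = (x ∖ {j}) ∪ {i} ∈ G.
sh : ∀ {n} → Fin n → Fin n → Hyp n → Hyp n
sh i j G x =
  (G x ∧ not (i ∈ᵇ x ∧ not (j ∈ᵇ x) ∧ not (G ((x - i) ∪ ⁅ j ⁆))))
  ∨ (j ∈ᵇ x ∧ not (i ∈ᵇ x) ∧ not (G x) ∧ G ((x - j) ∪ ⁅ i ⁆))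

_≐_ : ∀ {n} → Hyp n → Hyp n → Set
G ≐ H = ∀ e → G e ≡ H e

LeftShifted : ∀ {n} → Hyp n → Set
LeftShifted G = ∀ i j → i <F j → sh j i G ≐ G

RightShifted : ∀ {n} → Hyp n → Set
RightShifted G = ∀ i j → i <F j → sh i j G ≐ G

shadow : ∀ {n} → Hyp n → Hyp n
shadow {n} G p = (∣ p ∣ ≡ᵇ 2) ∧ any (λ e → G e ∧ ⌊ p ⊆? e ⌋) (allSubsets n)

-- Among the pairs in 𝒢(n,s,t) maximising e(R ∪ B), choose one minimising the potential
-- Σ_{e ∈ R} Σ_{v ∈ e} v + Σ_{f ∈ B} Σ_{v ∈ f} (n − v). For i < j the pair (sh_{j→i} R, sh_{i→j} B)
-- lies in 𝒢(n,s,t) again (shifting preserves uniformity, distinguishability and the matching bound)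
-- and has the same e(R ∪ B), since shifts preserve edge counts and R, B share no edge. Every edge the
-- shifts move loses j − i of potential, so by minimality no edge moves: R is closed under replacing
-- j by i in its edges and B under replacing i by j. Such closure passes to the shadow, because a pair
-- inside an edge e is carried by the replacement to a pair inside the replaced edge (or inside e itself).

module Submission where

open import Defs

open import Data.Bool using (Bool; true; false; _∧_; _∨_; not; if_then_else_)
import Data.Bool as Bool
open import Data.Bool.ListAction using (any)
open import Data.Bool.Properties
  using (∧-zeroʳ; ∧-identityʳ; ∨-zeroʳ; ∨-identityʳ; ∧-conicalˡ; ∧-conicalʳ; not-injective; T-≡)
open import Data.Empty using (⊥)
open import Data.Fin using (Fin; toℕ) renaming (zero to fzero; suc to fsuc; _<_ to _<ᶠ_)
open import Data.Fin.Permutation.Components using (transpose; transpose-inverse)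
open import Data.Fin.Properties using (_≟_; toℕ≤n)
open import Data.Fin.Subset using (Subset; _∩_; _∪_; _─_; _-_; ⁅_⁆; ∣_∣; _∈_; _⊆_)
open import Data.Fin.Subset.Properties
  using (x∈⁅x⁆; x≢y⇒x∉⁅y⁆; _⊆?_; x∈p∩q⁺; x∈p∩q⁻; p⊆q⇒∣p∣≤∣q∣; x∈p⇒∣p-x∣<∣p∣; ∩-idem)
open import Data.Integer as ℤ using (ℤ)
import Data.Integer.Properties as ℤ
open import Data.List
  using (List; []; _∷_; map; _++_; length; take; filter; cartesianProductWith; cartesianProduct)
open import Data.List.Extrema.Nat
  using (argmax; argmin; argmax-all; argmin-all; f[xs]≤f[argmax]; f[argmin]≤f[xs])
open import Data.List.Membership.Propositional using (find; lose) renaming (_∈_ to _∈ₗ_)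
open import Data.List.Membership.Propositional.Properties
  using (∈-++⁺ˡ; ∈-++⁺ʳ; ∈-map⁺; ∈-filter⁺; ∈-cartesianProductWith⁺; ∈-cartesianProduct⁺)
open import Data.List.Properties using (map-++; map-∘; length-map; length-take)
open import Data.List.Relation.Unary.All using (all?)
import Data.List.Relation.Unary.All as All
import Data.List.Relation.Unary.All.Properties as All
open import Data.List.Relation.Unary.AllPairs using (AllPairs; _∷_)
import Data.List.Relation.Unary.AllPairs as AllPairs
import Data.List.Relation.Unary.AllPairs.Properties as AllPairs
open import Data.List.Relation.Unary.Any using (here; there; any?)
open import Data.List.Relation.Unary.Any.Properties using (any⁺; any⁻)
open import Data.Nat using (ℕ; zero; suc; _+_; _∸_; _≤_; _<_; s≤s)
open import Data.Nat.ListAction using (sum)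
open import Data.Nat.ListAction.Properties using (sum-++)
open import Data.Nat.Properties
  using ( +-identityʳ; +-comm; +-assoc; +-cancelʳ-≡; +-cancelˡ-≤; *-cancelˡ-≡; m∸n+n≡m
        ; ≤-refl; ≤-trans; <⇒≤; <-irrefl; n≮0; 1+n≰n; ≮⇒≥; m≤m+n; m≤n+m; n≤0⇒n≡0
        ; m+n≡0⇒m≡0; m+n≡0⇒n≡0; m<n⇒0<n∸m; ∸-monoʳ-<; m≤n⇒m⊓n≡m; ≡ᵇ⇒≡; ≡⇒≡ᵇ
        ; +-commutativeSemigroup )
import Data.Nat.Properties as ℕ
open import Algebra.Properties.CommutativeSemigroup +-commutativeSemigroup using (interchange)
open import Data.Product using (_×_; _,_; ∃; ∃₂; proj₁; proj₂)
open import Data.Sum using (_⊎_; inj₁; inj₂)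
open import Data.Vec using (Vec; []; _∷_; lookup; tabulate; _[_]≔_; insertAt)
open import Data.Vec.Properties
  using ( tabulate∘lookup; tabulate-cong; lookup∘update; lookup∘update′; []≔-lookup; lookup-zipWith
        ; []=⇒lookup; lookup⇒[]=; insertAt-lookup )
open import Function using (_∘_)
open import Function.Bundles using (Equivalence)
open import Relation.Binary.PropositionalEquality
open import Relation.Nullary using (Dec; yes; no; contradiction)
open import Relation.Nullary.Decidable
  using (dec-true; dec-false; ⌊_⌋; toWitness; fromWitness; map′; _×-dec_; _→-dec_)
open import Relation.Unary using (Decidable)

open ≡-Reasoning

private variable
  n : ℕ

-- Transposing two coordinates of a subset

lookup-ext : {A : Set} {u v : Vec A n} → (∀ k → lookup u k ≡ lookup v k) → u ≡ v
lookup-ext {u = u} {v} eq = begin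
  u                    ≡⟨ tabulate∘lookup u ⟨
  tabulate (lookup u)  ≡⟨ tabulate-cong eq ⟩
  tabulate (lookup v)  ≡⟨ tabulate∘lookup v ⟩
  v                    ∎

lookup-⁅⁆-≡ : (i : Fin n) → lookup ⁅ i ⁆ i ≡ true
lookup-⁅⁆-≡ i = []=⇒lookup (x∈⁅x⁆ i)

lookup-⁅⁆-≢ : {i k : Fin n} → k ≢ i → lookup ⁅ i ⁆ k ≡ false
lookup-⁅⁆-≢ {i = i} {k} k≢i with lookup ⁅ i ⁆ k in eq
... | true  = contradiction (lookup⇒[]= k ⁅ i ⁆ eq) (x≢y⇒x∉⁅y⁆ k≢i)
... | false = refl

transpose-matchˡ : (i j : Fin n) → transpose i j i ≡ j
transpose-matchˡ i j rewrite dec-true (i ≟ i) refl = refl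

transpose-matchʳ : (i j : Fin n) → transpose i j j ≡ i
transpose-matchʳ i j with j ≟ i
... | yes refl = refl
... | no j≢i rewrite dec-true (j ≟ j) refl = refl

transpose-mismatch : {i j k : Fin n} → k ≢ i → k ≢ j → transpose i j k ≡ k
transpose-mismatch {i = i} {j} {k} k≢i k≢j
  rewrite dec-false (k ≟ i) k≢i | dec-false (k ≟ j) k≢j = refl

transpose-comm : (i j k : Fin n) → transpose i j k ≡ transpose j i k
transpose-comm i j k = by-cases (k ≟ i) (k ≟ j)
  where
  by-cases : Dec (k ≡ i) → Dec (k ≡ j) → transpose i j k ≡ transpose j i k
  by-cases (yes refl) _          = trans (transpose-matchˡ k j) (sym (transpose-matchʳ j k))
  by-cases (no _)     (yes refl) = trans (transpose-matchʳ i k) (sym (transpose-matchˡ k i))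
  by-cases (no k≢i)   (no k≢j)   = trans (transpose-mismatch k≢i k≢j) (sym (transpose-mismatch k≢j k≢i))

transpose-involutive : (i j k : Fin n) → transpose i j (transpose i j k) ≡ k
transpose-involutive i j k = trans (cong (transpose i j) (transpose-comm i j k)) (transpose-inverse i j)

swap : Fin n → Fin n → Subset n → Subset n
swap a b x = (x [ a ]≔ lookup x b) [ b ]≔ lookup x a

lookup-swap : (a b : Fin n) (x : Subset n) (k : Fin n) → lookup (swap a b x) k ≡ lookup x (transpose a b k)
lookup-swap a b x k = by-cases (k ≟ b) (k ≟ a)
  where
  by-cases : Dec (k ≡ b) → Dec (k ≡ a) → lookup (swap a b x) k ≡ lookup x (transpose a b k)
  by-cases (yes refl) _ =
    trans (lookup∘update k (x [ a ]≔ lookup x k) (lookup x a)) (cong (lookup x) (sym (transpose-matchʳ a k)))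
  by-cases (no k≢b) (yes refl) = begin
    lookup ((x [ k ]≔ lookup x b) [ b ]≔ lookup x k) k
      ≡⟨ lookup∘update′ k≢b (x [ k ]≔ lookup x b) (lookup x k) ⟩
    lookup (x [ k ]≔ lookup x b) k                      ≡⟨ lookup∘update k x _ ⟩
    lookup x b                                          ≡⟨ cong (lookup x) (transpose-matchˡ k b) ⟨
    lookup x (transpose k b k)                          ∎
  by-cases (no k≢b) (no k≢a) = begin
    lookup ((x [ a ]≔ lookup x b) [ b ]≔ lookup x a) k
      ≡⟨ lookup∘update′ k≢b (x [ a ]≔ lookup x b) (lookup x a) ⟩
    lookup (x [ a ]≔ lookup x b) k                      ≡⟨ lookup∘update′ k≢a x (lookup x b) ⟩
    lookup x k                                          ≡⟨ cong (lookup x) (transpose-mismatch k≢a k≢b) ⟨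
    lookup x (transpose a b k)                          ∎

swap-involutive : (a b : Fin n) (x : Subset n) → swap a b (swap a b x) ≡ x
swap-involutive a b x = lookup-ext λ k →
  trans (lookup-swap a b (swap a b x) k)
    (trans (lookup-swap a b x (transpose a b k)) (cong (lookup x) (transpose-involutive a b k)))

swap-comm : (a b : Fin n) (x : Subset n) → swap b a x ≡ swap a b x
swap-comm a b x = lookup-ext λ k →
  trans (lookup-swap b a x k) (trans (cong (lookup x) (transpose-comm b a k)) (sym (lookup-swap a b x k)))

swap-∩ : (a b : Fin n) (x y : Subset n) → swap a b (x ∩ y) ≡ swap a b x ∩ swap a b y
swap-∩ a b x y = lookup-ext λ k → begin
  lookup (swap a b (x ∩ y)) k                   ≡⟨ lookup-swap a b (x ∩ y) k ⟩
  lookup (x ∩ y) (transpose a b k)              ≡⟨ lookup-zipWith _∧_ (transpose a b k) x y ⟩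
  lookup x (transpose a b k) ∧ lookup y (transpose a b k)
    ≡⟨ cong₂ _∧_ (lookup-swap a b x k) (lookup-swap a b y k) ⟨
  lookup (swap a b x) k ∧ lookup (swap a b y) k ≡⟨ lookup-zipWith _∧_ k (swap a b x) (swap a b y) ⟨
  lookup (swap a b x ∩ swap a b y) k            ∎

swap-unmoved : (a b : Fin n) (x : Subset n) → lookup x a ≡ lookup x b → swap a b x ≡ x
swap-unmoved a b x eq = begin
  (x [ a ]≔ lookup x b) [ b ]≔ lookup x a  ≡⟨ cong (λ c → (x [ a ]≔ c) [ b ]≔ lookup x a) eq ⟨
  (x [ a ]≔ lookup x a) [ b ]≔ lookup x a  ≡⟨ cong (_[ b ]≔ lookup x a) ([]≔-lookup x a) ⟩
  x [ b ]≔ lookup x a                      ≡⟨ cong (x [ b ]≔_) eq ⟩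
  x [ b ]≔ lookup x b                      ≡⟨ []≔-lookup x b ⟩
  x                                        ∎

swap-lookupˡ : (a b : Fin n) (x : Subset n) → lookup (swap a b x) a ≡ lookup x b
swap-lookupˡ a b x = trans (lookup-swap a b x a) (cong (lookup x) (transpose-matchˡ a b))

swap-lookupʳ : (a b : Fin n) (x : Subset n) → lookup (swap a b x) b ≡ lookup x a
swap-lookupʳ a b x = trans (lookup-swap a b x b) (cong (lookup x) (transpose-matchʳ a b))

data SwapView (a b : Fin n) (x : Subset n) : Set where
  unmoved : lookup x a ≡ lookup x b → SwapView a b x
  source  : lookup x a ≡ true → lookup x b ≡ false → SwapView a b x
  target  : lookup x a ≡ false → lookup x b ≡ true → SwapView a b x

swapView : (a b : Fin n) (x : Subset n) → SwapView a b x
swapView a b x with lookup x a in xa | lookup x b in xb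
... | true  | true  = unmoved (trans xa (sym xb))
... | false | false = unmoved (trans xa (sym xb))
... | true  | false = source xa xb
... | false | true  = target xa xb

target⇒swap-source : (a b : Fin n) (x : Subset n) → lookup x a ≡ false → lookup x b ≡ true →
  lookup (swap a b x) a ≡ true × lookup (swap a b x) b ≡ false
target⇒swap-source a b x xa xb = trans (swap-lookupˡ a b x) xb , trans (swap-lookupʳ a b x) xa

lookup-─ : (p q : Subset n) (k : Fin n) → lookup (p ─ q) k ≡ lookup p k ∧ not (lookup q k)
lookup-─ (c ∷ p) (true  ∷ q) fzero    = sym (∧-zeroʳ c)
lookup-─ (c ∷ p) (false ∷ q) fzero    = sym (∧-identityʳ c)
lookup-─ (_ ∷ p) (_     ∷ q) (fsuc k) = lookup-─ p q k

source⇒≢ : {a b : Fin n} (x : Subset n) → lookup x a ≡ true → lookup x b ≡ false → a ≢ b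
source⇒≢ x xa xb refl with () ← trans (sym xa) xb

-- The edge (e ∖ {a}) ∪ {b} that sh_{a→b} substitutes for e is the transposed edge.
move≡swap : (a b : Fin n) (x : Subset n) → lookup x a ≡ true → lookup x b ≡ false →
  (x - a) ∪ ⁅ b ⁆ ≡ swap a b x
move≡swap a b x xa xb = lookup-ext λ k → begin
  lookup ((x - a) ∪ ⁅ b ⁆) k                          ≡⟨ lookup-zipWith _∨_ k (x - a) ⁅ b ⁆ ⟩
  lookup (x - a) k ∨ lookup ⁅ b ⁆ k                   ≡⟨ cong (_∨ lookup ⁅ b ⁆ k) (lookup-─ x ⁅ a ⁆ k) ⟩
  (lookup x k ∧ not (lookup ⁅ a ⁆ k)) ∨ lookup ⁅ b ⁆ k ≡⟨ by-cases k (k ≟ a) (k ≟ b) ⟩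
  lookup x (transpose a b k)                          ≡⟨ lookup-swap a b x k ⟨
  lookup (swap a b x) k                               ∎
  where
  a≢b : a ≢ b
  a≢b = source⇒≢ x xa xb
  by-cases : ∀ k → Dec (k ≡ a) → Dec (k ≡ b) →
    (lookup x k ∧ not (lookup ⁅ a ⁆ k)) ∨ lookup ⁅ b ⁆ k ≡ lookup x (transpose a b k)
  by-cases .a (yes refl) _ = begin
    (lookup x a ∧ not (lookup ⁅ a ⁆ a)) ∨ lookup ⁅ b ⁆ a
      ≡⟨ cong₂ (λ u v → (lookup x a ∧ not u) ∨ v) (lookup-⁅⁆-≡ a) (lookup-⁅⁆-≢ a≢b) ⟩
    (lookup x a ∧ false) ∨ false   ≡⟨ cong (_∨ false) (∧-zeroʳ (lookup x a)) ⟩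
    false                          ≡⟨ xb ⟨
    lookup x b                     ≡⟨ cong (lookup x) (transpose-matchˡ a b) ⟨
    lookup x (transpose a b a)     ∎
  by-cases .b (no b≢a) (yes refl) = begin
    (lookup x b ∧ not (lookup ⁅ a ⁆ b)) ∨ lookup ⁅ b ⁆ b
      ≡⟨ cong₂ (λ u v → (lookup x b ∧ not u) ∨ v) (lookup-⁅⁆-≢ b≢a) (lookup-⁅⁆-≡ b) ⟩
    (lookup x b ∧ true) ∨ true     ≡⟨ ∨-zeroʳ (lookup x b ∧ true) ⟩
    true                           ≡⟨ xa ⟨
    lookup x a                     ≡⟨ cong (lookup x) (transpose-matchʳ a b) ⟨
    lookup x (transpose a b b)     ∎
  by-cases k (no k≢a) (no k≢b) = begin
    (lookup x k ∧ not (lookup ⁅ a ⁆ k)) ∨ lookup ⁅ b ⁆ k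
      ≡⟨ cong₂ (λ u v → (lookup x k ∧ not u) ∨ v) (lookup-⁅⁆-≢ k≢a) (lookup-⁅⁆-≢ k≢b) ⟩
    (lookup x k ∧ true) ∨ false    ≡⟨ ∨-identityʳ (lookup x k ∧ true) ⟩
    lookup x k ∧ true              ≡⟨ ∧-identityʳ (lookup x k) ⟩
    lookup x k                     ≡⟨ cong (lookup x) (transpose-mismatch k≢a k≢b) ⟨
    lookup x (transpose a b k)     ∎

weight : (Fin n → ℕ) → Subset n → ℕ
weight ω []      = 0
weight ω (c ∷ x) = (if c then ω fzero else 0) + weight (ω ∘ fsuc) x

weight-update : (ω : Fin n → ℕ) (x : Subset n) (k : Fin n) (c : Bool) →
  weight ω (x [ k ]≔ c) + (if lookup x k then ω k else 0) ≡ weight ω x + (if c then ω k else 0)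
weight-update ω (d ∷ x) fzero c = begin
  (C + W) + D  ≡⟨ +-assoc C W D ⟩
  C + (W + D)  ≡⟨ +-comm C (W + D) ⟩
  (W + D) + C  ≡⟨ cong (_+ C) (+-comm W D) ⟩
  (D + W) + C  ∎
  where
  C D W : ℕ
  C = if c then ω fzero else 0
  D = if d then ω fzero else 0
  W = weight (ω ∘ fsuc) x
weight-update ω (d ∷ x) (fsuc k) c = begin
  (D + weight ω′ (x [ k ]≔ c)) + K  ≡⟨ +-assoc D _ K ⟩
  D + (weight ω′ (x [ k ]≔ c) + K)  ≡⟨ cong (D +_) (weight-update ω′ x k c) ⟩
  D + (weight ω′ x + C)             ≡⟨ +-assoc D _ C ⟨
  (D + weight ω′ x) + C             ∎
  where
  ω′ : Fin _ → ℕ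
  ω′ = ω ∘ fsuc
  C D K : ℕ
  C = if c then ω (fsuc k) else 0
  D = if d then ω fzero else 0
  K = if lookup x k then ω (fsuc k) else 0

weight-swap : (ω : Fin n → ℕ) (a b : Fin n) (x : Subset n) → lookup x a ≡ true → lookup x b ≡ false →
  weight ω (swap a b x) + ω a ≡ weight ω x + ω b
weight-swap ω a b x xa xb = begin
  weight ω (swap a b x) + ω a         ≡⟨ cong₂ (λ u v → weight ω ((x [ a ]≔ u) [ b ]≔ v) + ω a) xb xa ⟩
  weight ω (y [ b ]≔ true) + ω a      ≡⟨ cong (_+ ω a) (+-identityʳ _) ⟨
  (weight ω (y [ b ]≔ true) + 0) + ω a
                                      ≡⟨ cong (λ c → (weight ω (y [ b ]≔ true) + (if c then ω b else 0)) + ω a) yb ⟨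
  (weight ω (y [ b ]≔ true) + (if lookup y b then ω b else 0)) + ω a
                                      ≡⟨ cong (_+ ω a) (weight-update ω y b true) ⟩
  (weight ω y + ω b) + ω a            ≡⟨ +-assoc (weight ω y) (ω b) (ω a) ⟩
  weight ω y + (ω b + ω a)            ≡⟨ cong (weight ω y +_) (+-comm (ω b) (ω a)) ⟩
  weight ω y + (ω a + ω b)            ≡⟨ +-assoc (weight ω y) (ω a) (ω b) ⟨
  (weight ω y + ω a) + ω b            ≡⟨ cong (λ c → (weight ω y + (if c then ω a else 0)) + ω b) xa ⟨
  (weight ω y + (if lookup x a then ω a else 0)) + ω b
                                      ≡⟨ cong (_+ ω b) (weight-update ω x a false) ⟩
  (weight ω x + 0) + ω b              ≡⟨ cong (_+ ω b) (+-identityʳ (weight ω x)) ⟩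
  weight ω x + ω b                    ∎
  where
  y : Subset _
  y = x [ a ]≔ false
  yb : lookup y b ≡ false
  yb = trans (lookup∘update′ (≢-sym (source⇒≢ x xa xb)) x false) xb

weight-swap-drop : (ω : Fin n → ℕ) (a b : Fin n) (x : Subset n) → ω b ≤ ω a →
  lookup x a ≡ true → lookup x b ≡ false → weight ω x ≡ weight ω (swap a b x) + (ω a ∸ ω b)
weight-swap-drop ω a b x ωb≤ωa xa xb = +-cancelʳ-≡ (ω b) _ _ (begin
  weight ω x + ω b                           ≡⟨ weight-swap ω a b x xa xb ⟨
  weight ω (swap a b x) + ω a                ≡⟨ cong (weight ω (swap a b x) +_) (m∸n+n≡m ωb≤ωa) ⟨
  weight ω (swap a b x) + (ω a ∸ ω b + ω b)  ≡⟨ +-assoc (weight ω (swap a b x)) _ (ω b) ⟨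
  weight ω (swap a b x) + (ω a ∸ ω b) + ω b  ∎)

∣∣≡weight : (x : Subset n) → ∣ x ∣ ≡ weight (λ _ → 1) x
∣∣≡weight []          = refl
∣∣≡weight (true  ∷ x) = cong suc (∣∣≡weight x)
∣∣≡weight (false ∷ x) = ∣∣≡weight x

swap-pairs-elim : (a b : Fin n) (P : Subset n → Subset n → Set) → (∀ {x y} → P x y → P y x) →
  (∀ x → lookup x a ≡ lookup x b → P x x) →
  (∀ x → lookup x a ≡ true → lookup x b ≡ false → P x (swap a b x)) →
  ∀ x → P x (swap a b x)
swap-pairs-elim a b P P-sym P-unmoved P-source x with swapView a b x
... | unmoved eq   = subst (P x) (sym (swap-unmoved a b x eq)) (P-unmoved x eq)
... | source xa xb = P-source x xa xb
... | target xa xb = let ya , yb = target⇒swap-source a b x xa xb in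
  P-sym (subst (P (swap a b x)) (swap-involutive a b x) (P-source (swap a b x) ya yb))

∣swap∣ : (a b : Fin n) (x : Subset n) → ∣ swap a b x ∣ ≡ ∣ x ∣
∣swap∣ a b = swap-pairs-elim a b (λ x y → ∣ y ∣ ≡ ∣ x ∣) sym (λ _ _ → refl) λ x xa xb →
  +-cancelʳ-≡ 1 _ _ (begin
    ∣ swap a b x ∣ + 1             ≡⟨ cong (_+ 1) (∣∣≡weight (swap a b x)) ⟩
    weight _ (swap a b x) + 1      ≡⟨ weight-swap (λ _ → 1) a b x xa xb ⟩
    weight _ x + 1                 ≡⟨ cong (_+ 1) (∣∣≡weight x) ⟨
    ∣ x ∣ + 1                      ∎)

-- Sums over all subsets

∑ : (Subset n → ℕ) → ℕ
∑ {zero}  h = h []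
∑ {suc n} h = ∑ (h ∘ (false ∷_)) + ∑ (h ∘ (true ∷_))

∑-cong : {h g : Subset n → ℕ} → (∀ x → h x ≡ g x) → ∑ h ≡ ∑ g
∑-cong {zero}  eq = eq []
∑-cong {suc n} eq = cong₂ _+_ (∑-cong (eq ∘ (false ∷_))) (∑-cong (eq ∘ (true ∷_)))

∑-distrib-+ : (h g : Subset n → ℕ) → ∑ (λ x → h x + g x) ≡ ∑ h + ∑ g
∑-distrib-+ {zero}  h g = refl
∑-distrib-+ {suc n} h g = begin
  ∑ (λ x → h (false ∷ x) + g (false ∷ x)) + ∑ (λ x → h (true ∷ x) + g (true ∷ x))
    ≡⟨ cong₂ _+_ (∑-distrib-+ (h ∘ (false ∷_)) (g ∘ (false ∷_)))
                 (∑-distrib-+ (h ∘ (true ∷_)) (g ∘ (true ∷_))) ⟩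
  (∑ (h ∘ (false ∷_)) + ∑ (g ∘ (false ∷_))) + (∑ (h ∘ (true ∷_)) + ∑ (g ∘ (true ∷_)))
    ≡⟨ interchange (∑ (h ∘ (false ∷_))) (∑ (g ∘ (false ∷_)))
                   (∑ (h ∘ (true ∷_))) (∑ (g ∘ (true ∷_))) ⟩
  (∑ (h ∘ (false ∷_)) + ∑ (h ∘ (true ∷_))) + (∑ (g ∘ (false ∷_)) + ∑ (g ∘ (true ∷_))) ∎

∑-const-0 : ∑ {n} (λ _ → 0) ≡ 0
∑-const-0 {zero}  = refl
∑-const-0 {suc n} = cong₂ _+_ (∑-const-0 {n}) (∑-const-0 {n})

term≤∑ : (h : Subset n → ℕ) (x : Subset n) → h x ≤ ∑ h
term≤∑ h []          = ≤-refl
term≤∑ h (false ∷ x) = ≤-trans (term≤∑ (h ∘ (false ∷_)) x) (m≤m+n _ _)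
term≤∑ h (true  ∷ x) = ≤-trans (term≤∑ (h ∘ (true ∷_)) x) (m≤n+m _ _)

∑≡0⇒term≡0 : (h : Subset n → ℕ) → ∑ h ≡ 0 → ∀ x → h x ≡ 0
∑≡0⇒term≡0 h ∑≡0 x = n≤0⇒n≡0 (subst (h x ≤_) ∑≡0 (term≤∑ h x))

sum-allSubsets : (h : Subset n → ℕ) → sum (map h (allSubsets n)) ≡ ∑ h
sum-allSubsets {zero}  h = +-identityʳ (h [])
sum-allSubsets {suc n} h = begin
  sum (map h (map (false ∷_) xs ++ map (true ∷_) xs))
    ≡⟨ cong sum (map-++ h (map (false ∷_) xs) (map (true ∷_) xs)) ⟩
  sum (map h (map (false ∷_) xs) ++ map h (map (true ∷_) xs))
    ≡⟨ sum-++ (map h (map (false ∷_) xs)) _ ⟩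
  sum (map h (map (false ∷_) xs)) + sum (map h (map (true ∷_) xs))
    ≡⟨ cong₂ _+_ (cong sum (map-∘ xs)) (cong sum (map-∘ xs)) ⟨
  sum (map (h ∘ (false ∷_)) xs) + sum (map (h ∘ (true ∷_)) xs)
    ≡⟨ cong₂ _+_ (sum-allSubsets (h ∘ (false ∷_))) (sum-allSubsets (h ∘ (true ∷_))) ⟩
  ∑ (h ∘ (false ∷_)) + ∑ (h ∘ (true ∷_)) ∎
  where
  xs : List (Subset n)
  xs = allSubsets n

allSubsets-complete : (x : Subset n) → x ∈ₗ allSubsets n
allSubsets-complete []          = here refl
allSubsets-complete (false ∷ x) = ∈-++⁺ˡ (∈-map⁺ (false ∷_) (allSubsets-complete x))
allSubsets-complete (true  ∷ x) = ∈-++⁺ʳ (map (false ∷_) _) (∈-map⁺ (true ∷_) (allSubsets-complete x))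

insertAt-update : {A : Set} (w : Vec A n) (k : Fin (suc n)) (c d : A) → insertAt w k c [ k ]≔ d ≡ insertAt w k d
insertAt-update w       fzero    c d = refl
insertAt-update (x ∷ w) (fsuc k) c d = cong (x ∷_) (insertAt-update w k c d)

∑-insertAt : (k : Fin (suc n)) (h : Subset (suc n) → ℕ) →
  ∑ h ≡ ∑ (λ w → h (insertAt w k false)) + ∑ (λ w → h (insertAt w k true))
∑-insertAt         fzero    h = refl
∑-insertAt {suc n} (fsuc k) h = begin
  ∑ (h ∘ (false ∷_)) + ∑ (h ∘ (true ∷_))
    ≡⟨ cong₂ _+_ (∑-insertAt k (h ∘ (false ∷_))) (∑-insertAt k (h ∘ (true ∷_))) ⟩
  (part false false + part false true) + (part true false + part true true)
    ≡⟨ interchange (part false false) (part false true) (part true false) (part true true) ⟩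
  (part false false + part true false) + (part false true + part true true) ∎
  where
  part : Bool → Bool → ℕ
  part c d = ∑ (λ w → h (c ∷ insertAt w k d))

-- Swapping coordinate 0 with coordinate suc k: the summand becomes h (x_k ∷ x[k := c]).
∑-swap₀ : (k : Fin (suc n)) (h : Subset (suc (suc n)) → ℕ) →
  ∑ (λ x → h (lookup x k ∷ x [ k ]≔ false)) + ∑ (λ x → h (lookup x k ∷ x [ k ]≔ true)) ≡ ∑ h
∑-swap₀ k h = begin
  ∑ (λ x → h (lookup x k ∷ x [ k ]≔ false)) + ∑ (λ x → h (lookup x k ∷ x [ k ]≔ true))
    ≡⟨ cong₂ _+_ (∑-insertAt k (λ x → h (lookup x k ∷ x [ k ]≔ false)))
                 (∑-insertAt k (λ x → h (lookup x k ∷ x [ k ]≔ true))) ⟩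
  (swapped false false + swapped true false) + (swapped false true + swapped true true)
    ≡⟨ cong₂ _+_ (cong₂ _+_ (∑-cong (simplify false false)) (∑-cong (simplify true false)))
                 (cong₂ _+_ (∑-cong (simplify false true)) (∑-cong (simplify true true))) ⟩
  (part false false + part true false) + (part false true + part true true)
    ≡⟨ interchange (part false false) (part true false) (part false true) (part true true) ⟩
  (part false false + part false true) + (part true false + part true true)
    ≡⟨ cong₂ _+_ (∑-insertAt k (h ∘ (false ∷_))) (∑-insertAt k (h ∘ (true ∷_))) ⟨
  ∑ (h ∘ (false ∷_)) + ∑ (h ∘ (true ∷_)) ∎
  where
  part swapped : Bool → Bool → ℕ
  part c d = ∑ (λ w → h (c ∷ insertAt w k d))
  swapped c d = ∑ (λ w → h (lookup (insertAt w k c) k ∷ insertAt w k c [ k ]≔ d))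
  simplify : ∀ c d w → h (lookup (insertAt w k c) k ∷ insertAt w k c [ k ]≔ d) ≡ h (c ∷ insertAt w k d)
  simplify c d w = cong h (cong₂ _∷_ (insertAt-lookup w k c) (insertAt-update w k c d))

∑-swap : (a b : Fin n) (h : Subset n → ℕ) → ∑ (h ∘ swap a b) ≡ ∑ h
∑-swap {suc n}       fzero    fzero    h = refl
∑-swap {suc (suc n)} fzero    (fsuc b) h = ∑-swap₀ b h
∑-swap {suc (suc n)} (fsuc a) fzero    h = ∑-swap₀ a h
∑-swap {suc n}       (fsuc a) (fsuc b) h = cong₂ _+_ (∑-swap a b (h ∘ (false ∷_))) (∑-swap a b (h ∘ (true ∷_)))

∑-pairing : (a b : Fin n) (l r : Subset n → ℕ) →
  (∀ x → l x + l (swap a b x) ≡ r x + r (swap a b x)) → ∑ l ≡ ∑ r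
∑-pairing a b l r eq = *-cancelˡ-≡ (∑ l) (∑ r) 2 (begin
  ∑ l + (∑ l + 0)              ≡⟨ cong (∑ l +_) (+-identityʳ (∑ l)) ⟩
  ∑ l + ∑ l                    ≡⟨ cong (∑ l +_) (∑-swap a b l) ⟨
  ∑ l + ∑ (l ∘ swap a b)       ≡⟨ ∑-distrib-+ l (l ∘ swap a b) ⟨
  ∑ (λ x → l x + l (swap a b x)) ≡⟨ ∑-cong eq ⟩
  ∑ (λ x → r x + r (swap a b x)) ≡⟨ ∑-distrib-+ r (r ∘ swap a b) ⟩
  ∑ r + ∑ (r ∘ swap a b)       ≡⟨ cong (∑ r +_) (∑-swap a b r) ⟩
  ∑ r + ∑ r                    ≡⟨ cong (∑ r +_) (+-identityʳ (∑ r)) ⟨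
  ∑ r + (∑ r + 0)              ∎)

-- The shift operator

∧-true⁻ : ∀ {p q} → p ∧ q ≡ true → p ≡ true × q ≡ true
∧-true⁻ {p} {q} eq = ∧-conicalˡ p q eq , ∧-conicalʳ p q eq

∨-true⁻ : ∀ {p q} → p ∨ q ≡ true → p ≡ true ⊎ q ≡ true
∨-true⁻ {true}  _  = inj₁ refl
∨-true⁻ {false} eq = inj₂ eq

∧-absorb : ∀ {g h} → (g ≡ true → h ≡ true) → g ∧ h ≡ g
∧-absorb {true}  g⇒h = g⇒h refl
∧-absorb {false} _   = refl

∨-absorb : ∀ {g h} → (h ≡ true → g ≡ true) → g ∨ h ≡ g
∨-absorb {true}          _   = refl
∨-absorb {false} {true}  h⇒g with () ← h⇒g refl
∨-absorb {false} {false} _   = refl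

-- sh a b G x unfolds to sh-shape (G x) (a ∈ᵇ x) (b ∈ᵇ x) (G ((x - a) ∪ ⁅ b ⁆)) (G ((x - b) ∪ ⁅ a ⁆)).
sh-shape : Bool → Bool → Bool → Bool → Bool → Bool
sh-shape g p q r s = (g ∧ not (p ∧ not q ∧ not r)) ∨ (q ∧ not p ∧ not g ∧ s)

sh-shape-unmoved : ∀ g p r s → sh-shape g p p r s ≡ g
sh-shape-unmoved true  true  r s = refl
sh-shape-unmoved true  false r s = refl
sh-shape-unmoved false true  r s = refl
sh-shape-unmoved false false r s = refl

sh-shape-source : ∀ g r s → sh-shape g true false r s ≡ g ∧ r
sh-shape-source true  true  s = refl
sh-shape-source true  false s = refl
sh-shape-source false r     s = refl

sh-shape-target : ∀ g r s → sh-shape g false true r s ≡ g ∨ s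
sh-shape-target true  r s = refl
sh-shape-target false r s = refl

module _ (a b : Fin n) (G : Hyp n) (x : Subset n) where
  private
    G-move G-back : Bool
    G-move = G ((x - a) ∪ ⁅ b ⁆)
    G-back = G ((x - b) ∪ ⁅ a ⁆)

  sh-unmoved : lookup x a ≡ lookup x b → sh a b G x ≡ G x
  sh-unmoved eq = begin
    sh a b G x                                              ≡⟨ cong (λ q → sh-shape (G x) (lookup x a) q G-move G-back) eq ⟨
    sh-shape (G x) (lookup x a) (lookup x a) G-move G-back  ≡⟨ sh-shape-unmoved (G x) (lookup x a) G-move G-back ⟩
    G x                                                     ∎

  sh-source : lookup x a ≡ true → lookup x b ≡ false → sh a b G x ≡ G x ∧ G (swap a b x)
  sh-source xa xb = begin
    sh a b G x                                    ≡⟨ cong₂ (λ p q → sh-shape (G x) p q G-move G-back) xa xb ⟩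
    sh-shape (G x) true false G-move G-back       ≡⟨ sh-shape-source (G x) G-move G-back ⟩
    G x ∧ G ((x - a) ∪ ⁅ b ⁆)                     ≡⟨ cong (λ y → G x ∧ G y) (move≡swap a b x xa xb) ⟩
    G x ∧ G (swap a b x)                          ∎

  sh-target : lookup x a ≡ false → lookup x b ≡ true → sh a b G x ≡ G x ∨ G (swap a b x)
  sh-target xa xb = begin
    sh a b G x                                    ≡⟨ cong₂ (λ p q → sh-shape (G x) p q G-move G-back) xa xb ⟩
    sh-shape (G x) false true G-move G-back       ≡⟨ sh-shape-target (G x) G-move G-back ⟩
    G x ∨ G ((x - b) ∪ ⁅ a ⁆)                     ≡⟨ cong (λ y → G x ∨ G y) (move≡swap b a x xb xa) ⟩
    G x ∨ G (swap b a x)                          ≡⟨ cong (λ y → G x ∨ G y) (swap-comm a b x) ⟩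
    G x ∨ G (swap a b x)                          ∎

ShiftedEdge : Fin n → Fin n → Hyp n → Subset n → Set
ShiftedEdge a b G x =
  (G x ≡ true × G (swap a b x) ≡ true)
  ⊎ (lookup x a ≡ false × lookup x b ≡ true × (G x ≡ true ⊎ G (swap a b x) ≡ true))

sh-edge : (a b : Fin n) (G : Hyp n) (x : Subset n) → sh a b G x ≡ true → ShiftedEdge a b G x
sh-edge a b G x edge with swapView a b x
... | unmoved eq   = let Gx = trans (sym (sh-unmoved a b G x eq)) edge in
                     inj₁ (Gx , trans (cong G (swap-unmoved a b x eq)) Gx)
... | source xa xb = inj₁ (∧-true⁻ (trans (sym (sh-source a b G x xa xb)) edge))
... | target xa xb = inj₂ (xa , xb , ∨-true⁻ (trans (sym (sh-target a b G x xa xb)) edge))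

movable : Fin n → Fin n → Hyp n → Hyp n
movable a b G x = G x ∧ a ∈ᵇ x ∧ not (b ∈ᵇ x) ∧ not (G (swap a b x))

ShiftClosed : Fin n → Fin n → Hyp n → Set
ShiftClosed a b G = ∀ x → G x ≡ true → a ∈ᵇ x ≡ true → b ∈ᵇ x ≡ false → G (swap a b x) ≡ true

weightSum : (Subset n → ℕ) → Hyp n → ℕ
weightSum w G = ∑ (λ x → if G x then w x else 0)

edges#≡weightSum : (G : Hyp n) → edges# G ≡ weightSum (λ _ → 1) G
edges#≡weightSum G = sum-allSubsets (λ x → if G x then 1 else 0)

weightSum-cong : (w : Subset n → ℕ) {G H : Hyp n} → G ≐ H → weightSum w G ≡ weightSum w H
weightSum-cong w G≐H = ∑-cong λ x → cong (λ g → if g then w x else 0) (G≐H x)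

edges#-cong : {G H : Hyp n} → G ≐ H → edges# G ≡ edges# H
edges#-cong {G = G} {H} G≐H =
  trans (edges#≡weightSum G) (trans (weightSum-cong (λ _ → 1) G≐H) (sym (edges#≡weightSum H)))

p∧¬p∧q≡false : ∀ p q → p ∧ not p ∧ q ≡ false
p∧¬p∧q≡false true  q = refl
p∧¬p∧q≡false false q = refl

module _ (a b : Fin n) (G : Hyp n) (w : Subset n → ℕ) (c : ℕ)
         (w-drop : ∀ x → lookup x a ≡ true → lookup x b ≡ false → w x ≡ w (swap a b x) + c) where
  private
    before after : Subset n → ℕ
    before x = if G x then w x else 0
    after x = (if sh a b G x then w x else 0) + (if movable a b G x then c else 0)

    pair-arith : ∀ g h {wx wy} → wx ≡ wy + c →
      (if g then wx else 0) + (if h then wy else 0)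
        ≡ ((if g ∧ h then wx else 0) + (if g ∧ not h then c else 0)) + ((if h ∨ g then wy else 0) + 0)
    pair-arith true  true  {wx} {wy} _ = sym (cong₂ _+_ (+-identityʳ wx) (+-identityʳ wy))
    pair-arith true  false {wx} {wy} eq = begin
      wx + 0        ≡⟨ +-identityʳ wx ⟩
      wx            ≡⟨ eq ⟩
      wy + c        ≡⟨ +-comm wy c ⟩
      c + wy        ≡⟨ cong (c +_) (+-identityʳ wy) ⟨
      c + (wy + 0)  ∎
    pair-arith false true  {wy = wy} _ = sym (+-identityʳ wy)
    pair-arith false false _  = refl

    unmoved-pair : ∀ x → lookup x a ≡ lookup x b → before x ≡ after x
    unmoved-pair x eq = begin
      before x      ≡⟨ +-identityʳ (before x) ⟨
      before x + 0  ≡⟨ cong₂ (λ g m → (if g then w x else 0) + (if m then c else 0))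
                             (sym (sh-unmoved a b G x eq)) (sym not-movable) ⟩
      after x       ∎
      where
      not-movable : movable a b G x ≡ false
      not-movable = begin
        G x ∧ lookup x a ∧ not (lookup x b) ∧ not Gy  ≡⟨ cong (λ q → G x ∧ lookup x a ∧ not q ∧ not Gy) eq ⟨
        G x ∧ lookup x a ∧ not (lookup x a) ∧ not Gy  ≡⟨ cong (G x ∧_) (p∧¬p∧q≡false (lookup x a) (not Gy)) ⟩
        G x ∧ false                                    ≡⟨ ∧-zeroʳ (G x) ⟩
        false                                          ∎
        where
        Gy : Bool
        Gy = G (swap a b x)

    source-pair : ∀ x → lookup x a ≡ true → lookup x b ≡ false →
      before x + before (swap a b x) ≡ after x + after (swap a b x)
    source-pair x xa xb = begin
      before x + before y
        ≡⟨ pair-arith (G x) (G y) (w-drop x xa xb) ⟩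
      ((if G x ∧ G y then w x else 0) + (if G x ∧ not (G y) then c else 0)) + ((if G y ∨ G x then w y else 0) + 0)
        ≡⟨ cong₂ _+_ (cong₂ (λ g m → (if g then w x else 0) + (if m then c else 0)) (sym sh-x) (sym movable-x))
                     (cong₂ (λ g m → (if g then w y else 0) + (if m then c else 0)) (sym sh-y) (sym movable-y)) ⟩
      after x + after y ∎
      where
      y : Subset n
      y = swap a b x
      ya : lookup y a ≡ false
      ya = trans (swap-lookupˡ a b x) xb
      yb : lookup y b ≡ true
      yb = trans (swap-lookupʳ a b x) xa
      sh-x : sh a b G x ≡ G x ∧ G y
      sh-x = sh-source a b G x xa xb
      sh-y : sh a b G y ≡ G y ∨ G x
      sh-y = trans (sh-target a b G y ya yb) (cong (λ z → G y ∨ G z) (swap-involutive a b x))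
      movable-x : movable a b G x ≡ G x ∧ not (G y)
      movable-x = cong₂ (λ p q → G x ∧ p ∧ not q ∧ not (G y)) xa xb
      movable-y : movable a b G y ≡ false
      movable-y = trans (cong (λ p → G y ∧ p ∧ not (lookup y b) ∧ not (G (swap a b y))) ya) (∧-zeroʳ (G y))

  -- Pair x with swap a b x: an edge moved by sh a b lands on a set of weight c less.
  weightSum-sh : weightSum w G ≡ weightSum w (sh a b G) + weightSum (λ _ → c) (movable a b G)
  weightSum-sh = trans (∑-pairing a b before after pairs)
    (∑-distrib-+ (λ x → if sh a b G x then w x else 0) (λ x → if movable a b G x then c else 0))
    where
    pairs : ∀ x → before x + before (swap a b x) ≡ after x + after (swap a b x)
    pairs = swap-pairs-elim a b (λ x y → before x + before y ≡ after x + after y)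
      (λ {x} {y} eq → trans (+-comm (before y) (before x)) (trans eq (+-comm (after x) (after y))))
      (λ x eq → cong₂ _+_ (unmoved-pair x eq) (unmoved-pair x eq)) source-pair

weightSum-const-0 : (G : Hyp n) → weightSum (λ _ → 0) G ≡ 0
weightSum-const-0 {n} G = trans (∑-cong (λ x → if-0 (G x))) (∑-const-0 {n})
  where
  if-0 : ∀ g → (if g then 0 else 0) ≡ 0
  if-0 true  = refl
  if-0 false = refl

edges#-sh : (a b : Fin n) (G : Hyp n) → edges# (sh a b G) ≡ edges# G
edges#-sh a b G = begin
  edges# (sh a b G)                                            ≡⟨ edges#≡weightSum (sh a b G) ⟩
  weightSum one (sh a b G)                                     ≡⟨ +-identityʳ _ ⟨
  weightSum one (sh a b G) + 0
    ≡⟨ cong (weightSum one (sh a b G) +_) (weightSum-const-0 (movable a b G)) ⟨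
  weightSum one (sh a b G) + weightSum (λ _ → 0) (movable a b G) ≡⟨ weightSum-sh a b G one 0 (λ _ _ _ → refl) ⟨
  weightSum one G                                              ≡⟨ edges#≡weightSum G ⟨
  edges# G                                                     ∎
  where
  one : Subset _ → ℕ
  one _ = 1

weightSum-const≡0⇒empty : {c : ℕ} (H : Hyp n) → 0 < c → weightSum (λ _ → c) H ≡ 0 → ∀ x → H x ≡ false
weightSum-const≡0⇒empty {c = c} H 0<c sum≡0 x with H x | ∑≡0⇒term≡0 (λ x → if H x then c else 0) sum≡0 x
... | true  | c≡0 = contradiction (subst (0 <_) c≡0 0<c) (<-irrefl refl)
... | false | _   = refl

module _ {a b : Fin n} {G : Hyp n} where

  unmovable⇒closed : (∀ x → movable a b G x ≡ false) → ShiftClosed a b G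
  unmovable⇒closed unmovable x Gx xa xb = not-injective (begin
    not Gy                     ≡⟨ cong (λ q → not q ∧ not Gy) xb ⟨
    not (lookup x b) ∧ not Gy  ≡⟨ cong₂ (λ g p → g ∧ p ∧ not (lookup x b) ∧ not Gy) Gx xa ⟨
    movable a b G x            ≡⟨ unmovable x ⟩
    false                      ∎)
    where
    Gy : Bool
    Gy = G (swap a b x)

  closed⇒sh-fixed : ShiftClosed a b G → sh a b G ≐ G
  closed⇒sh-fixed closed x with swapView a b x
  ... | unmoved eq   = sh-unmoved a b G x eq
  ... | source xa xb = trans (sh-source a b G x xa xb) (∧-absorb λ Gx → closed x Gx xa xb)
  ... | target xa xb = trans (sh-target a b G x xa xb) (∨-absorb λ Gy →
    let ya , yb = target⇒swap-source a b x xa xb in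
    subst (λ z → G z ≡ true) (swap-involutive a b x) (closed (swap a b x) Gy ya yb))

  closed-swap : ShiftClosed a b G → ∀ {e} → G e ≡ true → lookup e a ≡ true → G (swap a b e) ≡ true
  closed-swap closed {e} Ge ea = by-cases (lookup e b) refl
    where
    by-cases : ∀ c → lookup e b ≡ c → G (swap a b e) ≡ true
    by-cases true  eb = trans (cong G (swap-unmoved a b e (trans ea (sym eb)))) Ge
    by-cases false eb = closed e Ge ea eb

-- Shadows

any-true⁻ : {A : Set} (f : A → Bool) (xs : List A) → any f xs ≡ true → ∃ λ x → x ∈ₗ xs × f x ≡ true
any-true⁻ f xs eq with x , x∈xs , fx ← find (any⁻ f xs (Equivalence.from T-≡ eq)) =
  x , x∈xs , Equivalence.to T-≡ fx

any-true⁺ : {A : Set} (f : A → Bool) {xs : List A} {x : A} → x ∈ₗ xs → f x ≡ true → any f xs ≡ true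
any-true⁺ f x∈xs fx = Equivalence.to T-≡ (any⁺ f (lose x∈xs (Equivalence.from T-≡ fx)))

shadow⁻ : (G : Hyp n) (p : Subset n) → shadow G p ≡ true → ∣ p ∣ ≡ 2 × ∃ λ e → G e ≡ true × p ⊆ e
shadow⁻ G p p∈∂G
  with size , covered ← ∧-true⁻ p∈∂G
  with e , _ , Ge∧p⊆e ← any-true⁻ (λ e → G e ∧ ⌊ p ⊆? e ⌋) (allSubsets _) covered
  with Ge , p⊆e ← ∧-true⁻ Ge∧p⊆e
  = ≡ᵇ⇒≡ ∣ p ∣ 2 (Equivalence.from T-≡ size) , e , Ge , toWitness {a? = p ⊆? e} (Equivalence.from T-≡ p⊆e)

shadow⁺ : (G : Hyp n) {p e : Subset n} → ∣ p ∣ ≡ 2 → G e ≡ true → p ⊆ e → shadow G p ≡ true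
shadow⁺ G {p} {e} size Ge p⊆e = cong₂ _∧_ (Equivalence.to T-≡ (≡⇒≡ᵇ ∣ p ∣ 2 size))
  (any-true⁺ (λ e → G e ∧ ⌊ p ⊆? e ⌋) (allSubsets-complete e)
    (cong₂ _∧_ Ge (Equivalence.to T-≡ (fromWitness {a? = p ⊆? e} p⊆e))))

swap-⊆ : (a b : Fin n) {p e : Subset n} → p ⊆ e → swap a b p ⊆ swap a b e
swap-⊆ a b {p} {e} p⊆e {k} k∈swap-p = lookup⇒[]= k (swap a b e) (begin
  lookup (swap a b e) k        ≡⟨ lookup-swap a b e k ⟩
  lookup e (transpose a b k)   ≡⟨ []=⇒lookup (p⊆e (lookup⇒[]= _ p p∋τk)) ⟩
  true                         ∎)
  where
  p∋τk : lookup p (transpose a b k) ≡ true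
  p∋τk = trans (sym (lookup-swap a b p k)) ([]=⇒lookup k∈swap-p)

shadow-closed : {a b : Fin n} {G : Hyp n} → ShiftClosed a b G → ShiftClosed a b (shadow G)
shadow-closed {a = a} {b} {G} closed p p∈∂G pa _ with size , e , Ge , p⊆e ← shadow⁻ G p p∈∂G =
  shadow⁺ G (trans (∣swap∣ a b p) size) (closed-swap closed Ge ([]=⇒lookup (p⊆e (lookup⇒[]= a p pa))))
    (swap-⊆ a b p⊆e)

-- Shifting keeps a pair in 𝒢(n,s,t)

IsKGraph-sh : {k : ℕ} (a b : Fin n) {G : Hyp n} → IsKGraph k G → IsKGraph k (sh a b G)
IsKGraph-sh a b {G} kG x x∈shG with sh-edge a b G x x∈shG
... | inj₁ (Gx , _)              = kG x Gx
... | inj₂ (_ , _ , inj₁ Gx)     = kG x Gx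
... | inj₂ (_ , _ , inj₂ Gswapx) = trans (sym (∣swap∣ a b x)) (kG _ Gswapx)

∣swap∩swap∣ : (a b : Fin n) (e f : Subset n) → ∣ swap a b e ∩ swap a b f ∣ ≡ ∣ e ∩ f ∣
∣swap∩swap∣ a b e f = trans (cong ∣_∣ (sym (swap-∩ a b e f))) (∣swap∣ a b (e ∩ f))

∈-swap-fixed : (a b : Fin n) {x : Subset n} {k : Fin n} → k ∈ x → k ≢ a → k ≢ b → k ∈ swap a b x
∈-swap-fixed a b {x} {k} k∈x k≢a k≢b = lookup⇒[]= k (swap a b x)
  (trans (lookup-swap a b x k) (trans (cong (lookup x) (transpose-mismatch k≢a k≢b)) ([]=⇒lookup k∈x)))

∈⇒≢ : {x : Subset n} {i k : Fin n} → lookup x i ≡ false → k ∈ x → k ≢ i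
∈⇒≢ xi k∈x refl with () ← trans (sym ([]=⇒lookup k∈x)) xi

-- If b ∉ e and a ∉ f then no vertex of e ∩ f is touched by the swap.
module _ (a b : Fin n) {e f : Subset n} (eb : lookup e b ≡ false) (fa : lookup f a ≡ false) where

  ∩-⊆-swapʳ : e ∩ f ⊆ e ∩ swap a b f
  ∩-⊆-swapʳ k∈e∩f with k∈e , k∈f ← x∈p∩q⁻ e f k∈e∩f =
    x∈p∩q⁺ (k∈e , ∈-swap-fixed a b k∈f (∈⇒≢ fa k∈f) (∈⇒≢ eb k∈e))

  ∩-⊆-swapˡ : e ∩ f ⊆ swap a b e ∩ f
  ∩-⊆-swapˡ k∈e∩f with k∈e , k∈f ← x∈p∩q⁻ e f k∈e∩f =
    x∈p∩q⁺ (∈-swap-fixed a b k∈e (∈⇒≢ fa k∈f) (∈⇒≢ eb k∈e) , k∈f)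

Distinguishable-sh : (a b : Fin n) {R B : Hyp n} → Distinguishable R B → Distinguishable (sh b a R) (sh a b B)
Distinguishable-sh a b {R} {B} dist e f e∈R′ f∈B′ = cases (sh-edge b a R e e∈R′) (sh-edge a b B f f∈B′)
  where
  R-swap : R (swap b a e) ≡ true → R (swap a b e) ≡ true
  R-swap = subst (λ z → R z ≡ true) (swap-comm a b e)
  both-swapped : R (swap b a e) ≡ true → B (swap a b f) ≡ true → ∣ e ∩ f ∣ ≤ 1
  both-swapped Re′ Bf′ = subst (_≤ 1) (∣swap∩swap∣ a b e f) (dist _ _ (R-swap Re′) Bf′)
  cases : ShiftedEdge b a R e → ShiftedEdge a b B f → ∣ e ∩ f ∣ ≤ 1
  cases (inj₁ (Re , _))            (inj₁ (Bf , _))             = dist e f Re Bf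
  cases (inj₁ (Re , _))            (inj₂ (_ , _ , inj₁ Bf))    = dist e f Re Bf
  cases (inj₂ (_ , _ , inj₁ Re))   (inj₁ (Bf , _))             = dist e f Re Bf
  cases (inj₂ (_ , _ , inj₁ Re))   (inj₂ (_ , _ , inj₁ Bf))    = dist e f Re Bf
  cases (inj₁ (_ , Re′))           (inj₂ (_ , _ , inj₂ Bf′))   = both-swapped Re′ Bf′
  cases (inj₂ (_ , _ , inj₂ Re′))  (inj₁ (_ , Bf′))            = both-swapped Re′ Bf′
  cases (inj₂ (_ , _ , inj₂ Re′))  (inj₂ (_ , _ , inj₂ Bf′))   = both-swapped Re′ Bf′
  cases (inj₂ (eb , _ , inj₁ Re))  (inj₂ (fa , _ , inj₂ Bf′))  =
    ≤-trans (p⊆q⇒∣p∣≤∣q∣ (∩-⊆-swapʳ a b {e} {f} eb fa)) (dist _ _ Re Bf′)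
  cases (inj₂ (eb , _ , inj₂ Re′)) (inj₂ (fa , _ , inj₁ Bf))   =
    ≤-trans (p⊆q⇒∣p∣≤∣q∣ (∩-⊆-swapˡ a b {e} {f} eb fa)) (dist _ _ (R-swap Re′) Bf)

AllPairs-∈ : {A : Set} {_~_ : A → A → Set} {xs : List A} {x y : A} →
  AllPairs _~_ xs → x ∈ₗ xs → y ∈ₗ xs → x ≡ y ⊎ x ~ y ⊎ y ~ x
AllPairs-∈ (_ ∷ _)      (here refl) (here refl) = inj₁ refl
AllPairs-∈ (x~ys ∷ _)   (here refl) (there y∈)  = inj₂ (inj₁ (All.lookup x~ys y∈))
AllPairs-∈ (y~xs ∷ _)   (there x∈)  (here refl) = inj₂ (inj₂ (All.lookup y~xs x∈))
AllPairs-∈ (_ ∷ pairs)  (there x∈)  (there y∈)  = AllPairs-∈ pairs x∈ y∈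

∈⇒∣∣≢0 : {p : Subset n} {k : Fin n} → k ∈ p → ∣ p ∣ ≢ 0
∈⇒∣∣≢0 {p = p} {k} k∈p ∣p∣≡0 = n≮0 (subst (∣ p - k ∣ <_) ∣p∣≡0 (x∈p⇒∣p-x∣<∣p∣ k∈p))

-- A matching of sh_{a→b}(R) either lies in R or, if some edge x₀ is new (so b ∈ x₀),
-- its swap is a matching of R: an unswapped old edge containing b would meet x₀.
matching-sh : (a b : Fin n) {R : Hyp n} {M : List (Subset n)} → IsMatching (sh a b R) M →
  ∃ λ M′ → IsMatching R M′ × length M′ ≡ length M
matching-sh a b {R} {M} (M⊆R′ , disjoint) with all? (λ e → R e Bool.≟ true) M
... | yes M⊆R = M , (M⊆R , disjoint) , refl
... | no M⊈R with x₀ , x₀∈M , ¬Rx₀ ← find (All.¬All⇒Any¬ (λ e → R e Bool.≟ true) M M⊈R) =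
  map (swap a b) M ,
  (All.map⁺ (All.tabulate swapped-edge) ,
   AllPairs.map⁺ (AllPairs.map (λ {e} {f} e∩f≡0 → trans (∣swap∩swap∣ a b e f) e∩f≡0) disjoint)) ,
  length-map (swap a b) M
  where
  b∈x₀ : b ∈ x₀
  b∈x₀ with sh-edge a b R x₀ (All.lookup M⊆R′ x₀∈M)
  ... | inj₁ (Rx₀ , _)           = contradiction Rx₀ ¬Rx₀
  ... | inj₂ (_ , _ , inj₁ Rx₀)  = contradiction Rx₀ ¬Rx₀
  ... | inj₂ (_ , x₀b , inj₂ _)  = lookup⇒[]= b x₀ x₀b
  swapped-edge : ∀ {x} → x ∈ₗ M → R (swap a b x) ≡ true
  swapped-edge {x} x∈M with sh-edge a b R x (All.lookup M⊆R′ x∈M)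
  ... | inj₁ (_ , Rx′)           = Rx′
  ... | inj₂ (_ , _ , inj₂ Rx′)  = Rx′
  ... | inj₂ (_ , xb , inj₁ Rx) with AllPairs-∈ disjoint x∈M x₀∈M
  ...   | inj₁ refl              = contradiction Rx ¬Rx₀
  ...   | inj₂ (inj₁ x∩x₀≡0) = contradiction x∩x₀≡0 (∈⇒∣∣≢0 (x∈p∩q⁺ (lookup⇒[]= b x xb , b∈x₀)))
  ...   | inj₂ (inj₂ x₀∩x≡0) = contradiction x₀∩x≡0 (∈⇒∣∣≢0 (x∈p∩q⁺ (b∈x₀ , lookup⇒[]= b x xb)))

MatchingAtMost-sh : (a b : Fin n) {R : Hyp n} {s : ℤ} → MatchingAtMost R s → MatchingAtMost (sh a b R) s
MatchingAtMost-sh a b {s = s} R≤s M isM with M′ , isM′ , same-length ← matching-sh a b isM =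
  subst (λ l → ℤ.+ l ℤ.≤ s) same-length (R≤s M′ isM′)

edges#-∪ : (R B : Hyp n) → (∀ e → R e ≡ true → B e ≡ true → ⊥) → edges# (R ∪H B) ≡ edges# R + edges# B
edges#-∪ R B disjoint = begin
  edges# (R ∪H B)                      ≡⟨ edges#≡weightSum (R ∪H B) ⟩
  weightSum (λ _ → 1) (R ∪H B)         ≡⟨ ∑-cong (λ e → count (R e) (B e) (disjoint e)) ⟩
  ∑ (λ e → (if R e then 1 else 0) + (if B e then 1 else 0))
                                       ≡⟨ ∑-distrib-+ (λ e → if R e then 1 else 0) (λ e → if B e then 1 else 0) ⟩
  weightSum (λ _ → 1) R + weightSum (λ _ → 1) B
                                       ≡⟨ cong₂ _+_ (edges#≡weightSum R) (edges#≡weightSum B) ⟨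
  edges# R + edges# B                  ∎
  where
  count : ∀ r b → (r ≡ true → b ≡ true → ⊥) →
    (if r ∨ b then 1 else 0) ≡ (if r then 1 else 0) + (if b then 1 else 0)
  count true  true  not-both = contradiction refl (not-both refl)
  count true  false _        = refl
  count false b     _        = refl

-- An edge of both R and B would meet itself in more than one vertex.
Distinguishable⇒disjoint : {k : ℕ} {R B : Hyp n} → IsKGraph (suc (suc k)) R → Distinguishable R B →
  ∀ e → R e ≡ true → B e ≡ true → ⊥
Distinguishable⇒disjoint kR dist e Re Be
  with s≤s () ← subst (_≤ 1) (trans (cong ∣_∣ (∩-idem e)) (kR e Re)) (dist e e Re Be)

module _ {s t : ℤ} (a b : Fin n) {R B : Hyp n} where

  InG-sh : InG n s t R B → InG n s t (sh b a R) (sh a b B)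
  InG-sh (kR , kB , dist , R≤s , t<eR) =
    IsKGraph-sh b a kR , IsKGraph-sh a b kB , Distinguishable-sh a b dist , MatchingAtMost-sh b a R≤s ,
    subst (λ m → t ℤ.< ℤ.+ m) (sym (edges#-sh b a R)) t<eR

  edges#-∪-sh : InG n s t R B → edges# (sh b a R ∪H sh a b B) ≡ edges# (R ∪H B)
  edges#-∪-sh g@(kR , _ , dist , _) with kR′ , _ , dist′ , _ ← InG-sh g = begin
    edges# (sh b a R ∪H sh a b B)          ≡⟨ edges#-∪ _ _ (Distinguishable⇒disjoint kR′ dist′) ⟩
    edges# (sh b a R) + edges# (sh a b B)  ≡⟨ cong₂ _+_ (edges#-sh b a R) (edges#-sh a b B) ⟩
    edges# R + edges# B                    ≡⟨ edges#-∪ R B (Distinguishable⇒disjoint kR dist) ⟨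
    edges# (R ∪H B)                        ∎

-- A potential lowered by shifting

no-drop : ∀ {X X′ Y Y′ p q} → X + Y ≤ X′ + Y′ → X ≡ X′ + p → Y ≡ Y′ + q → p ≡ 0 × q ≡ 0
no-drop {X′ = X′} {Y′ = Y′} {p} {q} X+Y≤X′+Y′ refl refl = m+n≡0⇒m≡0 p p+q≡0 , m+n≡0⇒n≡0 p p+q≡0
  where
  p+q≡0 : p + q ≡ 0
  p+q≡0 = n≤0⇒n≡0 (+-cancelˡ-≤ (X′ + Y′) (p + q) 0
    (subst₂ _≤_ (interchange X′ p Y′ q) (sym (+-identityʳ (X′ + Y′))) X+Y≤X′+Y′))

weightSum-shift : (ω : Fin n → ℕ) (a b : Fin n) (G : Hyp n) → ω b ≤ ω a →
  weightSum (weight ω) G ≡ weightSum (weight ω) (sh a b G) + weightSum (λ _ → ω a ∸ ω b) (movable a b G)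
weightSum-shift ω a b G ωb≤ωa =
  weightSum-sh a b G (weight ω) (ω a ∸ ω b) λ x xa xb → weight-swap-drop ω a b x ωb≤ωa xa xb

-- Σ_{e ∈ R} Σ_{v ∈ e} v + Σ_{f ∈ B} Σ_{v ∈ f} (n − v): left shifts of R and right shifts of B lower it.
potential : Hyp n × Hyp n → ℕ
potential {n} (R , B) = weightSum (weight toℕ) R + weightSum (weight λ k → n ∸ toℕ k) B

PotentialMinimal : (n : ℕ) → ℤ → ℤ → Hyp n → Hyp n → Set
PotentialMinimal n s t R B = ∀ R′ B′ → InG n s t R′ B′ → edges# (R′ ∪H B′) ≡ edges# (R ∪H B) →
  potential (R , B) ≤ potential (R′ , B′)

minimal⇒closed : {s t : ℤ} {R B : Hyp n} → InG n s t R B → PotentialMinimal n s t R B →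
  {i j : Fin n} → i <ᶠ j → ShiftClosed j i R × ShiftClosed i j B
minimal⇒closed {n} {R = R} {B} g minimal {i} {j} i<j =
  unmovable⇒closed (weightSum-const≡0⇒empty (movable j i R) (m<n⇒0<n∸m i<j) (proj₁ drops≡0)) ,
  unmovable⇒closed (weightSum-const≡0⇒empty (movable i j B) (m<n⇒0<n∸m ω′j<ω′i) (proj₂ drops≡0))
  where
  ω′ : Fin n → ℕ
  ω′ k = n ∸ toℕ k
  ω′j<ω′i : ω′ j < ω′ i
  ω′j<ω′i = ∸-monoʳ-< i<j (toℕ≤n j)
  drops≡0 : weightSum (λ _ → toℕ j ∸ toℕ i) (movable j i R) ≡ 0
          × weightSum (λ _ → ω′ i ∸ ω′ j) (movable i j B) ≡ 0
  drops≡0 = no-drop (minimal _ _ (InG-sh i j g) (edges#-∪-sh i j g))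
                    (weightSum-shift toℕ j i R (<⇒≤ i<j)) (weightSum-shift ω′ i j B (<⇒≤ ω′j<ω′i))

closed⇒left-shifted : {G : Hyp n} → (∀ {i j} → i <ᶠ j → ShiftClosed j i G) →
  LeftShifted G × LeftShifted (shadow G)
closed⇒left-shifted closed =
  (λ i j i<j → closed⇒sh-fixed (closed i<j)) , (λ i j i<j → closed⇒sh-fixed (shadow-closed (closed i<j)))

closed⇒right-shifted : {G : Hyp n} → (∀ {i j} → i <ᶠ j → ShiftClosed i j G) →
  RightShifted G × RightShifted (shadow G)
closed⇒right-shifted closed =
  (λ i j i<j → closed⇒sh-fixed (closed i<j)) , (λ i j i<j → closed⇒sh-fixed (shadow-closed (closed i<j)))

-- Finite search for extremal pairs

glue : Hyp n → Hyp n → Hyp (suc n)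
glue G H (false ∷ x) = G x
glue G H (true  ∷ x) = H x

hypergraphs : (n : ℕ) → List (Hyp n)
hypergraphs zero    = (λ _ → false) ∷ (λ _ → true) ∷ []
hypergraphs (suc n) = cartesianProductWith glue (hypergraphs n) (hypergraphs n)

hypergraphs-complete : (G : Hyp n) → ∃ λ H → H ∈ₗ hypergraphs n × G ≐ H
hypergraphs-complete {zero} G with G [] in G[]
... | false = _ , here refl , λ { [] → G[] }
... | true  = _ , there (here refl) , λ { [] → G[] }
hypergraphs-complete {suc n} G
  with H₀ , H₀∈ , G₀≐H₀ ← hypergraphs-complete (G ∘ (false ∷_))
  with H₁ , H₁∈ , G₁≐H₁ ← hypergraphs-complete (G ∘ (true ∷_))
  = glue H₀ H₁ , ∈-cartesianProductWith⁺ glue H₀∈ H₁∈ ,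
    λ { (false ∷ x) → G₀≐H₀ x ; (true ∷ x) → G₁≐H₁ x }

∀-subsets? : {P : Subset n → Set} → Decidable P → Dec (∀ x → P x)
∀-subsets? P? = map′ (λ all x → All.lookup all (allSubsets-complete x)) (λ all → All.tabulate (λ {x} _ → all x))
                     (all? P? (allSubsets _))

listsOfLength : {A : Set} → List A → ℕ → List (List A)
listsOfLength xs zero    = [] ∷ []
listsOfLength xs (suc m) = cartesianProductWith _∷_ xs (listsOfLength xs m)

∈-listsOfLength : {A : Set} {xs : List A} → (∀ x → x ∈ₗ xs) →
  (ys : List A) → ys ∈ₗ listsOfLength xs (length ys)
∈-listsOfLength complete []       = here refl
∈-listsOfLength complete (y ∷ ys) = ∈-cartesianProductWith⁺ _∷_ (complete y) (∈-listsOfLength complete ys)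

isMatching? : (R : Hyp n) → Decidable (IsMatching R)
isMatching? R M = all? (λ e → R e Bool.≟ true) M ×-dec AllPairs.allPairs? (λ e f → ∣ e ∩ f ∣ ℕ.≟ 0) M

-- m(R) ≤ k iff no list of k + 1 subsets is a matching of R.
matchingAtMost? : (R : Hyp n) (s : ℤ) → Dec (MatchingAtMost R s)
matchingAtMost? R ℤ.-[1+ k ] = no λ R≤s → contradiction (R≤s [] (All.[] , AllPairs.[])) λ ()
matchingAtMost? R (ℤ.+ k)
  with any? (λ M → isMatching? R M ×-dec (length M ℕ.≟ suc k)) (listsOfLength (allSubsets _) (suc k))
... | yes found with M , _ , isM , |M|≡1+k ← find found =
  no λ R≤k → contradiction (subst (λ l → ℤ.+ l ℤ.≤ ℤ.+ k) |M|≡1+k (R≤k M isM))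
                           λ { (ℤ.+≤+ 1+k≤k) → 1+n≰n 1+k≤k }
... | no none = yes λ M isM → ℤ.+≤+ (≮⇒≥ λ k<|M| →
  let prefix = take (suc k) M
      |prefix|≡1+k = trans (length-take (suc k) M) (m≤n⇒m⊓n≡m k<|M|)
  in none (lose (subst (λ l → prefix ∈ₗ listsOfLength (allSubsets _) l) |prefix|≡1+k
                       (∈-listsOfLength allSubsets-complete prefix))
                ((All.take⁺ (suc k) (proj₁ isM) , AllPairs.take⁺ (suc k) (proj₂ isM)) , |prefix|≡1+k)))

InG? : (n : ℕ) (s t : ℤ) (R B : Hyp n) → Dec (InG n s t R B)
InG? n s t R B =
  isKGraph? R ×-dec isKGraph? B
  ×-dec ∀-subsets? (λ e → ∀-subsets? λ f →
          (R e Bool.≟ true) →-dec ((B f Bool.≟ true) →-dec (∣ e ∩ f ∣ ℕ.≤? 1)))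
  ×-dec matchingAtMost? R s
  ×-dec (t ℤ.<? ℤ.+ edges# R)
  where
  isKGraph? : (G : Hyp n) → Dec (IsKGraph 3 G)
  isKGraph? G = ∀-subsets? λ e → (G e Bool.≟ true) →-dec (∣ e ∣ ℕ.≟ 3)

-- Hypergraphs are functions, so extremal ones are searched for among finitely many representatives up to ≐.
module FiniteSearch
  {A : Set} (_≈_ : A → A → Set) (enum : List A) (enum-complete : ∀ a → ∃ λ b → b ∈ₗ enum × a ≈ b)
  {P : A → Set} (P? : Decidable P) (P-resp : ∀ {a b} → a ≈ b → P a → P b)
  (f : A → ℕ) (f-resp : ∀ {a b} → a ≈ b → f a ≡ f b) where

  private
    candidates : List A
    candidates = filter P? enum

    representative : ∀ {a} → P a → ∃ λ b → b ∈ₗ candidates × f a ≡ f b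
    representative {a} Pa with b , b∈enum , a≈b ← enum-complete a =
      b , ∈-filter⁺ P? b∈enum (P-resp a≈b Pa) , f-resp a≈b

  maximiser : ∃ P → ∃ λ a → P a × ∀ b → P b → f b ≤ f a
  maximiser (a₀ , Pa₀) = best , argmax-all f Pa₀ (All.all-filter P? enum) , λ b Pb →
    let c , c∈ , fb≡fc = representative Pb in
    subst (_≤ f best) (sym fb≡fc) (All.lookup (f[xs]≤f[argmax] {f = f} a₀ candidates) c∈)
    where
    best : A
    best = argmax f a₀ candidates

  minimiser : ∃ P → ∃ λ a → P a × ∀ b → P b → f a ≤ f b
  minimiser (a₀ , Pa₀) = best , argmin-all f Pa₀ (All.all-filter P? enum) , λ b Pb →
    let c , c∈ , fb≡fc = representative Pb in
    subst (f best ≤_) (sym fb≡fc) (All.lookup (f[argmin]≤f[xs] {f = f} a₀ candidates) c∈)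
    where
    best : A
    best = argmin f a₀ candidates

_≐²_ : Hyp n × Hyp n → Hyp n × Hyp n → Set
(R , B) ≐² (R′ , B′) = R ≐ R′ × B ≐ B′

pairs : (n : ℕ) → List (Hyp n × Hyp n)
pairs n = cartesianProduct (hypergraphs n) (hypergraphs n)

pairs-complete : (p : Hyp n × Hyp n) → ∃ λ q → q ∈ₗ pairs n × p ≐² q
pairs-complete (R , B)
  with R′ , R′∈ , R≐R′ ← hypergraphs-complete R
  with B′ , B′∈ , B≐B′ ← hypergraphs-complete B
  = (R′ , B′) , ∈-cartesianProduct⁺ R′∈ B′∈ , R≐R′ , B≐B′

InG-resp : {s t : ℤ} {R R′ B B′ : Hyp n} → R ≐ R′ → B ≐ B′ → InG n s t R B → InG n s t R′ B′
InG-resp {t = t} R≐R′ B≐B′ (kR , kB , dist , R≤s , t<eR) =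
  (λ e R′e → kR e (trans (R≐R′ e) R′e)) ,
  (λ e B′e → kB e (trans (B≐B′ e) B′e)) ,
  (λ e f R′e B′f → dist e f (trans (R≐R′ e) R′e) (trans (B≐B′ f) B′f)) ,
  (λ M (M⊆R′ , disjoint) → R≤s M (All.map (trans (R≐R′ _)) M⊆R′ , disjoint)) ,
  subst (λ m → t ℤ.< ℤ.+ m) (edges#-cong R≐R′) t<eR

value : Hyp n × Hyp n → ℕ
value (R , B) = edges# (R ∪H B)

value-resp : {p q : Hyp n × Hyp n} → p ≐² q → value p ≡ value q
value-resp (R≐ , B≐) = edges#-cong λ x → cong₂ _∨_ (R≐ x) (B≐ x)

potential-resp : {p q : Hyp n × Hyp n} → p ≐² q → potential p ≡ potential q
potential-resp (R≐ , B≐) = cong₂ _+_ (weightSum-cong _ R≐) (weightSum-cong _ B≐)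

module _ {n : ℕ} (s t : ℤ) where

  Feasible : Hyp n × Hyp n → Set
  Feasible (R , B) = InG n s t R B

  feasible? : Decidable Feasible
  feasible? (R , B) = InG? n s t R B

  feasible-resp : {p q : Hyp n × Hyp n} → p ≐² q → Feasible p → Feasible q
  feasible-resp (R≐ , B≐) = InG-resp R≐ B≐

  Optimal : ℕ → Hyp n × Hyp n → Set
  Optimal μ p = Feasible p × value p ≡ μ

  optimal? : (μ : ℕ) → Decidable (Optimal μ)
  optimal? μ p = feasible? p ×-dec (value p ℕ.≟ μ)

  optimal-resp : {μ : ℕ} {p q : Hyp n × Hyp n} → p ≐² q → Optimal μ p → Optimal μ q
  optimal-resp p≐q (feasible , value≡μ) = feasible-resp p≐q feasible , trans (sym (value-resp p≐q)) value≡μ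

  optimal-pair : ∃₂ (λ R B → InG n s t R B) → ∃₂ λ R B → InM n s t R B × PotentialMinimal n s t R B
  optimal-pair (R₀ , B₀ , g₀)
    with (R₁ , B₁) , g₁ , largest ← FiniteSearch.maximiser _≐²_ (pairs n) pairs-complete
                                      feasible? feasible-resp value value-resp ((R₀ , B₀) , g₀)
    with (R , B) , (g , optimal) , least ← FiniteSearch.minimiser _≐²_ (pairs n) pairs-complete
                                      (optimal? (value (R₁ , B₁))) optimal-resp
                                      potential potential-resp ((R₁ , B₁) , g₁ , refl)
    = R , B , (g , λ R′ B′ g′ → subst (value (R′ , B′) ≤_) (sym optimal) (largest (R′ , B′) g′)) ,
      λ R′ B′ g′ same → least (R′ , B′) (g′ , trans same optimal)

corollary4p4 : (n : ℕ) (s t : ℤ) →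
    ∃₂ (λ R B → InG n s t R B) →
    ∃₂ (λ R B → InM n s t R B
                × LeftShifted R × LeftShifted (shadow R)
                × RightShifted B × RightShifted (shadow B))
corollary4p4 n s t nonempty with R , B , inM@(g , _) , minimal ← optimal-pair s t nonempty =
  let R-left , ∂R-left = closed⇒left-shifted (proj₁ ∘ minimal⇒closed g minimal)
      B-right , ∂B-right = closed⇒right-shifted (proj₂ ∘ minimal⇒closed g minimal)
  in R , B , inM , R-left , ∂R-left , B-right , ∂B-right
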